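{- Let $p$ be a prime and $q$ an integer with $\gcd(q,p)=1$. For $m\ge1$ let $A_m$ be the adjacency matrix of the directed graph $\Gamma_{p,m,q}$ with vertex set $\{0,1,\dots,p^m-1\}$ (rows and columns indexed in this natural order) and edge set $\{(x,\, q^y \bmod p^m): x\in\{0,\dots,p^m-1\},\ y\in\mathbb{Z}_{\ge0},\ y\equiv x\pmod{p^m}\}$. Then: (1) If $q$ is a primitive root modulo $p$, then $A_1$ is the $p\times p$ matrix whose first column is zero and all of whose other entries equal $1$. If $q$ is not a primitive root modulo $p$, then $A_1$ is obtained from this matrix by changing some entries $1$ to $0$. (2) For every $n>1$ there exist matrices $B^n_1,\dots,B^n_p\in\mathrm{Mat}_{p^{n-1}\times p^{n-1}}(\mathbb{Z})$ with $B^n_1+B^n_2+\dots+B^n_p=A_{n-1}$ such that, in $p\times p$ block form with blocks of size $p^{n-1}\times p^{n-1}$, $$A_n=\begin{pmatrix} B^n_1 & B^n_2 & \cdots & B^n_p\\ B^n_1 & B^n_2 & \cdots & B^n_p\\ \vdots & \vdots & & \vdots\\ B^n_1 & B^n_2 & \cdots & B^n_p\end{pmatrix}.$$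
   Context: Here $a\bmod p^m$ denotes the least nonnegative residue of $a$ modulo $p^m$. The block structure corresponds to writing each $x\in\{0,\dots,p^n-1\}$ as $x=y+bp^{n-1}$ with $y\in\{0,\dots,p^{n-1}-1\}$ and $b\in\{0,\dots,p-1\}$: the index $b$ numbers the blocks and $y$ numbers positions inside a block. -}

module Defs where

open import Data.Nat as ℕ using (ℕ; zero; suc; _∸_; NonZero; nonTrivial⇒nonZero)
open import Data.Nat.Properties using (m^n≢0)
open import Data.Nat.Primality using (Prime; prime)
open import Data.Integer as ℤ using (ℤ; _%ℕ_; 0ℤ; 1ℤ)
open import Data.Fin using (Fin; toℕ)
open import Data.Integer.GCD using (gcd)
import Data.Fin as Fin
open import Data.Product using (∃)
open import Relation.Binary.PropositionalEquality using (_≡_)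
open import Relation.Nullary using (¬_)

Matrix : ℕ → Set
Matrix N = Fin N → Fin N → ℤ

sumℤ : ∀ {k} → (Fin k → ℤ) → ℤ
sumℤ {zero}  f = 0ℤ
sumℤ {suc k} f = f Fin.zero ℤ.+ sumℤ (λ i → f (Fin.suc i))

resid : ∀ {p} → Prime p → (m : ℕ) → ℤ → ℕ
resid {p} (prime _) m a =
  _%ℕ_ a (p ℕ.^ m) {{m^n≢0 p m {{nonTrivial⇒nonZero p}}}}

Edge : ∀ {p} → Prime p → (m : ℕ) → ℤ → Fin (p ℕ.^ m) → Fin (p ℕ.^ m) → Set
Edge {p} pr m q x z =
  ∃ λ (y : ℕ) → resid pr m (ℤ.+ y) ≡ resid pr m (ℤ.+ toℕ x)
              × resid pr m (q ℤ.^ y) ≡ toℕ z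
  where open import Data.Product using (_×_)

IsAdjacencyMatrix : ∀ {p} → Prime p → (m : ℕ) → ℤ → Matrix (p ℕ.^ m) → Set
IsAdjacencyMatrix pr m q M =
  ∀ x z → (Edge pr m q x z → M x z ≡ 1ℤ) × (¬ Edge pr m q x z → M x z ≡ 0ℤ)
  where open import Data.Product using (_×_)

IsPrimitiveRootModPrime : ∀ {p} → Prime p → ℤ → Set
IsPrimitiveRootModPrime {p} pr q =
  gcd q (ℤ.+ p) ≡ 1ℤ
  × resid pr 1 (q ℤ.^ (p ∸ 1)) ≡ resid pr 1 1ℤ
  × (∀ k → 1 ℕ.≤ k → k ℕ.< p ∸ 1 → ¬ resid pr 1 (q ℤ.^ k) ≡ resid pr 1 1ℤ)
  where open import Data.Product using (_×_)

J₀ : (N : ℕ) → Matrix N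
J₀ N x z with toℕ z
... | zero  = 0ℤ
... | suc _ = 1ℤ

{-# OPTIONS --safe #-}
-- Since p ∤ q, the residue of q ^ y modulo p ^ m is a unit and depends only on y modulo a
-- period of q. For m = 1 no edge enters 0; if q is a primitive root every nonzero z is some
-- q ^ k, and an exponent y ≡ x (mod p), y ≡ k (mod p - 1) gives the edge (x, z); otherwise
-- q ^ k ≡ 1 for some k < p - 1 and only k nonzero targets occur.
-- For n = m + 1 with K = p ^ m and N = p ^ n, q ^ (e K) ≡ 1 (mod N) for some 1 ≤ e < p. As e
-- is invertible modulo p, an exponent t ≡ x (mod K) can be moved along multiples of e K to any
-- class over x modulo N without changing q ^ t mod N, so row x of A_n depends only on x mod K.
-- Reducing modulo K maps edges of Γ_n onto edges of Γ_m, and each edge (y, y′) of Γ_m lifts to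
-- exactly one edge (y, y′ + b K), since raising to the power e, prime to p, is injective on
-- the residues ≡ 1 (mod K) modulo N. Hence the blocks B_b (y, y′) = A_n (y, y′ + b K) sum to A_m.
module Submission where

open import Defs
open import Data.Nat as ℕ using (ℕ; _∸_; _^_; zero; suc; NonZero; z≤n; s≤s)
import Data.Nat.Properties as ℕP
import Data.Nat.DivMod as ℕD
import Data.Nat.Divisibility as ℕ∣
import Data.Nat.GCD as ℕGCD
import Data.Nat.Tactic.RingSolver as ℕSolver
open import Data.Nat.Primality using (Prime; euclidsLemma; prime⇒nonTrivial)
open import Data.Integer as ℤ using (ℤ; 0ℤ; 1ℤ; +_; _+_; _*_; _-_; -_; _%ℕ_) renaming (_^_ to _^ᶻ_)
import Data.Integer.Properties as ℤP
import Data.Integer.DivMod as ℤD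
open import Data.Integer.Divisibility.Signed
open import Data.Integer.GCD using (gcd)
open import Data.Integer.Tactic.RingSolver using (solve-∀)
open import Data.Fin as Fin using (Fin; toℕ; fromℕ<)
import Data.Fin.Properties as FinP
open import Data.Product using (Σ; ∃; ∃₂; _×_; _,_; proj₁; proj₂)
open import Data.Sum using (_⊎_; inj₁; inj₂) renaming (map to ⊎-map)
open import Data.Empty using (⊥-elim)
open import Function using (_∘_)
open import Level using (0ℓ)
open import Relation.Binary.Bundles using (Setoid)
open import Relation.Binary.Definitions using (tri<; tri≈; tri>)
open import Relation.Binary.PropositionalEquality
open import Relation.Nullary using (¬_; yes; no)
open import Relation.Nullary.Decidable using (decidable-stable; _×-dec_)

infix 4 _≡_mod_

record _≡_mod_ (a b : ℤ) (n : ℕ) : Set where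
  constructor ≡-mod
  field n∣a-b : + n ∣ a - b

module _ {n : ℕ} where

  mod-refl : ∀ {a} → a ≡ a mod n
  mod-refl {a} = ≡-mod (divides 0ℤ (identity a (+ n)))
    where identity : ∀ a n → a - a ≡ 0ℤ * n
          identity = solve-∀

  ≡⇒mod : ∀ {a b} → a ≡ b → a ≡ b mod n
  ≡⇒mod refl = mod-refl

  mod-sym : ∀ {a b} → a ≡ b mod n → b ≡ a mod n
  mod-sym {a} {b} (≡-mod n∣a-b) = ≡-mod (subst (+ n ∣_) (identity a b) (∣m⇒∣-m n∣a-b))
    where identity : ∀ a b → - (a - b) ≡ b - a
          identity = solve-∀

  mod-trans : ∀ {a b c} → a ≡ b mod n → b ≡ c mod n → a ≡ c mod n
  mod-trans {a} {b} {c} (≡-mod n∣a-b) (≡-mod n∣b-c) =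
    ≡-mod (subst (+ n ∣_) (identity a b c) (∣m∣n⇒∣m+n n∣a-b n∣b-c))
    where identity : ∀ a b c → (a - b) + (b - c) ≡ a - c
          identity = solve-∀

  +-cong-mod : ∀ {a b c d} → a ≡ b mod n → c ≡ d mod n → a + c ≡ b + d mod n
  +-cong-mod {a} {b} {c} {d} (≡-mod n∣a-b) (≡-mod n∣c-d) =
    ≡-mod (subst (+ n ∣_) (identity a b c d) (∣m∣n⇒∣m+n n∣a-b n∣c-d))
    where identity : ∀ a b c d → (a - b) + (c - d) ≡ (a + c) - (b + d)
          identity = solve-∀

  +-congˡ-mod : ∀ c {a b} → a ≡ b mod n → c + a ≡ c + b mod n
  +-congˡ-mod c = +-cong-mod (mod-refl {c})

  *-congˡ-mod : ∀ c {a b} → a ≡ b mod n → c * a ≡ c * b mod n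
  *-congˡ-mod c {a} {b} (≡-mod n∣a-b) = ≡-mod (subst (+ n ∣_) (identity c a b) (∣n⇒∣m*n c n∣a-b))
    where identity : ∀ c a b → c * (a - b) ≡ c * a - c * b
          identity = solve-∀

  *-cong-mod : ∀ {a b c d} → a ≡ b mod n → c ≡ d mod n → a * c ≡ b * d mod n
  *-cong-mod {a} {b} {c} {d} a≡b c≡d =
    mod-trans (subst₂ (_≡_mod n) (ℤP.*-comm c a) (ℤP.*-comm c b) (*-congˡ-mod c a≡b))
              (*-congˡ-mod b c≡d)

  ^-cong-mod : ∀ k {a b} → a ≡ b mod n → a ^ᶻ k ≡ b ^ᶻ k mod n
  ^-cong-mod zero    a≡b = mod-refl
  ^-cong-mod (suc k) a≡b = *-cong-mod a≡b (^-cong-mod k a≡b)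

  mod-0⇒∣ : ∀ {a} → a ≡ 0ℤ mod n → + n ∣ a
  mod-0⇒∣ {a} (≡-mod n∣a-0) = subst (+ n ∣_) (ℤP.+-identityʳ a) n∣a-0

  ^-periodic-mod : ∀ {a} E → a ^ᶻ E ≡ 1ℤ mod n → ∀ y j → a ^ᶻ (y ℕ.+ E ℕ.* j) ≡ a ^ᶻ y mod n
  ^-periodic-mod {a} E a^E≡1 y j = subst₂ (_≡_mod n) (sym split) (ℤP.*-identityʳ (a ^ᶻ y))
    (*-congˡ-mod (a ^ᶻ y) (subst ((a ^ᶻ E) ^ᶻ j ≡_mod n) (ℤP.^-zeroˡ j) (^-cong-mod j a^E≡1)))
    where split : a ^ᶻ (y ℕ.+ E ℕ.* j) ≡ a ^ᶻ y * (a ^ᶻ E) ^ᶻ j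
          split = trans (ℤP.^-distribˡ-+-* a y (E ℕ.* j)) (cong (a ^ᶻ y *_) (sym (ℤP.^-*-assoc a E j)))

mod-∣ : ∀ {m n a b} → m ℕ∣.∣ n → a ≡ b mod n → a ≡ b mod m
mod-∣ m∣n (≡-mod n∣a-b) = ≡-mod (∣-trans (∣ᵤ⇒∣ m∣n) n∣a-b)

mod-1 : ∀ a b → a ≡ b mod 1
mod-1 a b = ≡-mod (divides (a - b) (sym (ℤP.*-identityʳ (a - b))))

n≡0-mod : ∀ n → + n ≡ 0ℤ mod n
n≡0-mod n = ≡-mod (divides 1ℤ (identity (+ n)))
  where identity : ∀ n → n - 0ℤ ≡ 1ℤ * n
        identity = solve-∀

+*-mod : ∀ n a b → + (b ℕ.+ a ℕ.* n) ≡ + b mod n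
+*-mod n a b = ≡-mod (divides (+ a) (begin
  + (b ℕ.+ a ℕ.* n) - + b   ≡⟨ cong (_- + b) (trans (ℤP.pos-+ b (a ℕ.* n)) (cong (λ c → + b + c) (ℤP.pos-* a n))) ⟩
  + b + + a * + n - + b     ≡⟨ identity (+ b) (+ a * + n) ⟩
  + a * + n                 ∎))
  where open ≡-Reasoning
        identity : ∀ b c → b + c - b ≡ c
        identity = solve-∀

mod-setoid : ℕ → Setoid 0ℓ 0ℓ
mod-setoid n = record
  { Carrier = ℤ
  ; _≈_ = _≡_mod n
  ; isEquivalence = record { refl = mod-refl ; sym = mod-sym ; trans = mod-trans }
  }

module mod-Reasoning (n : ℕ) where
  open import Relation.Binary.Reasoning.Setoid (mod-setoid n) public

module _ (n : ℕ) .{{_ : NonZero n}} where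

  mod-%ℕ : ∀ a → a ≡ + (a %ℕ n) mod n
  mod-%ℕ a = ≡-mod (divides (a ℤ./ℕ n) (begin
    a - + (a %ℕ n)                          ≡⟨ cong (_- + (a %ℕ n)) (ℤD.a≡a%ℕn+[a/ℕn]*n a n) ⟩
    + (a %ℕ n) + a ℤ./ℕ n * + n - + (a %ℕ n) ≡⟨ identity (+ (a %ℕ n)) (a ℤ./ℕ n) (+ n) ⟩
    a ℤ./ℕ n * + n                          ∎))
    where open ≡-Reasoning
          identity : ∀ r k n → r + k * n - r ≡ k * n
          identity = solve-∀

  <-mod⇒≡ : ∀ {r s} → r ℕ.< n → s ℕ.< n → + r ≡ + s mod n → r ≡ s
  <-mod⇒≡ {r} {s} r<n s<n (≡-mod n∣r-s) =
    ℤP.+-injective (ℤP.i-j≡0⇒i≡j (+ r) (+ s) (ℤP.∣i∣≡0⇒i≡0 ∣r-s∣≡0))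
    where
    ∣r-s∣<n : ℤ.∣ + r - + s ∣ ℕ.< n
    ∣r-s∣<n = begin-strict
      ℤ.∣ + r - + s ∣ ≡⟨ cong ℤ.∣_∣ (ℤP.m-n≡m⊖n r s) ⟩
      ℤ.∣ r ℤ.⊖ s ∣   ≤⟨ ℤP.∣m⊝n∣≤m⊔n r s ⟩
      r ℕ.⊔ s         <⟨ ℕP.⊔-lub r<n s<n ⟩
      n               ∎
      where open ℕP.≤-Reasoning
    ∣r-s∣≡0 : ℤ.∣ + r - + s ∣ ≡ 0
    ∣r-s∣≡0 = trans (sym (ℕD.m<n⇒m%n≡m ∣r-s∣<n)) (ℕ∣.n∣m⇒m%n≡0 _ n (∣⇒∣ᵤ n∣r-s))

  %ℕ-cong : ∀ {a b} → a ≡ b mod n → a %ℕ n ≡ b %ℕ n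
  %ℕ-cong {a} {b} a≡b = <-mod⇒≡ (ℤD.n%ℕd<d a n) (ℤD.n%ℕd<d b n)
    (mod-trans (mod-sym (mod-%ℕ a)) (mod-trans a≡b (mod-%ℕ b)))

  %ℕ≡⇒mod : ∀ {a r} → a %ℕ n ≡ r → a ≡ + r mod n
  %ℕ≡⇒mod {a} refl = mod-%ℕ a

  %ℕ-injective-mod : ∀ {a b} → a %ℕ n ≡ b %ℕ n → a ≡ b mod n
  %ℕ-injective-mod {a} {b} eq = mod-trans (%ℕ≡⇒mod eq) (mod-sym (mod-%ℕ b))

  mod⇒%ℕ≡ : ∀ {a r} → r ℕ.< n → a ≡ + r mod n → a %ℕ n ≡ r
  mod⇒%ℕ≡ r<n a≡r = trans (%ℕ-cong a≡r) (ℕD.m<n⇒m%n≡m r<n)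

geometric : ℤ → ℕ → ℤ
geometric a zero    = 0ℤ
geometric a (suc n) = 1ℤ + a * geometric a n

geometric-identity : ∀ a n → (a - 1ℤ) * geometric a n ≡ a ^ᶻ n - 1ℤ
geometric-identity a zero    = ℤP.*-zeroʳ (a - 1ℤ)
geometric-identity a (suc n) = begin
  (a - 1ℤ) * (1ℤ + a * geometric a n)        ≡⟨ expand a (geometric a n) ⟩
  a - 1ℤ + a * ((a - 1ℤ) * geometric a n)    ≡⟨ cong (λ g → a - 1ℤ + a * g) (geometric-identity a n) ⟩
  a - 1ℤ + a * (a ^ᶻ n - 1ℤ)                 ≡⟨ collect a (a ^ᶻ n) ⟩
  a * a ^ᶻ n - 1ℤ                            ∎
  where open ≡-Reasoning
        expand : ∀ a g → (a - 1ℤ) * (1ℤ + a * g) ≡ a - 1ℤ + a * ((a - 1ℤ) * g)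
        expand = solve-∀
        collect : ∀ a b → a - 1ℤ + a * (b - 1ℤ) ≡ a * b - 1ℤ
        collect = solve-∀

geometric-mod : ∀ {m a} n → a ≡ 1ℤ mod m → geometric a n ≡ + n mod m
geometric-mod zero    a≡1 = mod-refl
geometric-mod {m} {a} (suc n) a≡1 = begin
  1ℤ + a * geometric a n ≈⟨ +-congˡ-mod 1ℤ (*-cong-mod a≡1 (geometric-mod n a≡1)) ⟩
  1ℤ + 1ℤ * + n          ≡⟨ cong (λ x → 1ℤ + x) (ℤP.*-identityˡ (+ n)) ⟩
  + suc n                ∎
  where open mod-Reasoning m

%≡⇒≡+* : ∀ {m o} n .{{_ : NonZero n}} → m ℕ.% n ≡ o ℕ.% n → m ℕ./ n ℕ.≤ o ℕ./ n →
         o ≡ m ℕ.+ n ℕ.* (o ℕ./ n ∸ m ℕ./ n)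
%≡⇒≡+* {m} {o} n m%n≡o%n m/n≤o/n = begin
  o                                     ≡⟨ ℕD.m≡m%n+[m/n]*n o n ⟩
  o ℕ.% n ℕ.+ o ℕ./ n ℕ.* n             ≡⟨ cong₂ (λ r a → r ℕ.+ a ℕ.* n) (sym m%n≡o%n) (sym (ℕP.m+[n∸m]≡n m/n≤o/n)) ⟩
  m ℕ.% n ℕ.+ (m ℕ./ n ℕ.+ d) ℕ.* n     ≡⟨ regroup (m ℕ.% n) (m ℕ./ n) d n ⟩
  m ℕ.% n ℕ.+ m ℕ./ n ℕ.* n ℕ.+ n ℕ.* d ≡⟨ cong (ℕ._+ n ℕ.* d) (ℕD.m≡m%n+[m/n]*n m n) ⟨
  m ℕ.+ n ℕ.* d                         ∎
  where
  open ≡-Reasoning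
  d : ℕ
  d = o ℕ./ n ∸ m ℕ./ n
  regroup : ∀ r a d n → r ℕ.+ (a ℕ.+ d) ℕ.* n ≡ r ℕ.+ a ℕ.* n ℕ.+ n ℕ.* d
  regroup = ℕSolver.solve-∀

-- n ≡ -1 (mod n + 1), so the exponent is ≡ k - (k - X) = X.
exponent-mod-suc : ∀ n k X → + (k ℕ.+ n ℕ.* (k ℕ.+ n ℕ.* X)) ≡ + X mod suc n
exponent-mod-suc zero    k X = mod-1 _ _
exponent-mod-suc (suc r) k X =
  subst (_≡ + X mod suc (suc r)) (cong +_ (sym (identity r k X))) (+*-mod (suc (suc r)) (k ℕ.+ r ℕ.* X) X)
  where identity : ∀ r k X →
                   k ℕ.+ suc r ℕ.* (k ℕ.+ suc r ℕ.* X) ≡ X ℕ.+ (k ℕ.+ r ℕ.* X) ℕ.* suc (suc r)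
        identity = ℕSolver.solve-∀

-- Leaving out a missed value t, f would inject Fin (1 + n) into Fin n.
injective⇒surjective : ∀ {n} (f : Fin n → Fin n) → (∀ {i j} → f i ≡ f j → i ≡ j) →
                       ∀ t → ∃ λ i → f i ≡ t
injective⇒surjective {suc n} f f-injective t with FinP.any? (λ i → f i FinP.≟ t)
... | yes hit  = hit
... | no  miss =
  let i , j , i<j , eq = FinP.pigeonhole (ℕP.n<1+n n) (λ i → Fin.punchOut (t≢f i))
  in ⊥-elim (ℕP.<-irrefl (cong toℕ (f-injective (FinP.punchOut-injective (t≢f i) (t≢f j) eq))) i<j)
  where t≢f : ∀ i → t ≢ f i
        t≢f i t≡fi = miss (i , sym t≡fi)

-- A section of a surjective f would inject Fin n into Fin k.
<-nonsurjective : ∀ {k n} → k ℕ.< n → (f : Fin k → Fin n) → ∃ λ t → ∀ i → f i ≢ t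
<-nonsurjective {k} {n} k<n f =
  let t , unhit = FinP.¬∀⟶∃¬ n (λ t → ∃ λ i → f i ≡ t) (λ t → FinP.any? (λ i → f i FinP.≟ t))
                              ¬surjective
  in t , λ i fi≡t → unhit (i , fi≡t)
  where
  ¬surjective : ¬ (∀ t → ∃ λ i → f i ≡ t)
  ¬surjective section =
    let s , t , s<t , eq = FinP.pigeonhole k<n (proj₁ ∘ section)
    in ℕP.<-irrefl (cong toℕ (trans (sym (proj₂ (section s))) (trans (cong f eq) (proj₂ (section t))))) s<t

module PrimePowers {p} (pr : Prime p) where

  instance
    p≢0 : NonZero p
    p≢0 = ℕ.nonTrivial⇒nonZero p {{prime⇒nonTrivial pr}}

  1<p : 1 ℕ.< p
  1<p = ℕ.nonTrivial⇒n>1 p {{prime⇒nonTrivial pr}}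

  p^1≡p : p ^ 1 ≡ p
  p^1≡p = ℕP.*-identityʳ p

  p∣p^suc : ∀ k → p ℕ∣.∣ p ^ suc k
  p∣p^suc k = ℕ∣.m∣m*n (p ^ k)

  <p⇒∤ : ∀ {e} → 1 ℕ.≤ e → e ℕ.< p → ¬ + p ∣ + e
  <p⇒∤ {suc e} _ e<p p∣e = ℕP.<⇒≱ e<p (ℕ∣.∣⇒≤ (∣⇒∣ᵤ p∣e))

  gcd≡1⇒∤ : ∀ {q} → gcd q (+ p) ≡ 1ℤ → ¬ + p ∣ q
  gcd≡1⇒∤ gcd≡1 p∣q = ℕP.<⇒≱ 1<p
    (ℕ∣.∣⇒≤ (subst (p ℕ∣.∣_) (ℤP.+-injective gcd≡1) (ℕGCD.gcd-greatest (∣⇒∣ᵤ p∣q) ℕ∣.∣-refl)))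

  euclid : ∀ a b → + p ∣ a * b → + p ∣ a ⊎ + p ∣ b
  euclid a b p∣ab = ⊎-map ∣ᵤ⇒∣ ∣ᵤ⇒∣
    (euclidsLemma ℤ.∣ a ∣ ℤ.∣ b ∣ pr (subst (p ℕ∣.∣_) (ℤP.abs-* a b) (∣⇒∣ᵤ p∣ab)))

  ∤-^ : ∀ {q} → ¬ + p ∣ q → ∀ i → ¬ + p ∣ q ^ᶻ i
  ∤-^ p∤q zero    p∣1 = ℕP.<⇒≱ 1<p (ℕ∣.∣⇒≤ (∣⇒∣ᵤ p∣1))
  ∤-^ {q} p∤q (suc i) p∣q^1+i with euclid q (q ^ᶻ i) p∣q^1+i
  ... | inj₁ p∣q   = p∤q p∣q
  ... | inj₂ p∣q^i = ∤-^ p∤q i p∣q^i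

  ∣-cancelˡ : ∀ k {c d} → ¬ + p ∣ c → + (p ^ k) ∣ c * d → + (p ^ k) ∣ d
  ∣-cancelˡ zero    {d = d} _ _ = divides d (sym (ℤP.*-identityʳ d))
  ∣-cancelˡ (suc k) {c} {d} p∤c p^1+k∣cd with euclid c d (∣-trans (∣ᵤ⇒∣ (p∣p^suc k)) p^1+k∣cd)
  ... | inj₁ p∣c = ⊥-elim (p∤c p∣c)
  ... | inj₂ (divides d′ refl) =
    subst₂ _∣_ (sym (ℤP.pos-* p (p ^ k))) (ℤP.*-comm (+ p) d′)
      (*-monoʳ-∣ (+ p) (∣-cancelˡ k p∤c p^k∣cd′))
    where
    p^k∣cd′ : + (p ^ k) ∣ c * d′
    p^k∣cd′ = *-cancelˡ-∣ (+ p) (subst₂ _∣_ (ℤP.pos-* p (p ^ k)) (regroup c d′ (+ p)) p^1+k∣cd)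
      where regroup : ∀ c d p → c * (d * p) ≡ p * (c * d)
            regroup = solve-∀

  *-cancelˡ-mod : ∀ k {c a b} → ¬ + p ∣ c → c * a ≡ c * b mod p ^ k → a ≡ b mod p ^ k
  *-cancelˡ-mod k {c} {a} {b} p∤c (≡-mod p^k∣ca-cb) =
    ≡-mod (∣-cancelˡ k p∤c (subst (+ (p ^ k) ∣_) (factor c a b) p^k∣ca-cb))
    where factor : ∀ c a b → c * a - c * b ≡ c * (a - b)
          factor = solve-∀

  ^p-lift : ∀ {k a} → a ≡ 1ℤ mod p ^ suc k → a ^ᶻ p ≡ 1ℤ mod p ^ suc (suc k)
  ^p-lift {k} {a} a≡1@(≡-mod (divides c a-1≡cp^k)) =
    let divides d geometric≡dp = mod-0⇒∣ geometric≡0 in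
    ≡-mod (divides (c * d) (begin
      a ^ᶻ p - 1ℤ                       ≡⟨ geometric-identity a p ⟨
      (a - 1ℤ) * geometric a p          ≡⟨ cong₂ _*_ a-1≡cp^k geometric≡dp ⟩
      c * + (p ^ suc k) * (d * + p)     ≡⟨ regroup c d (+ p) (+ (p ^ suc k)) ⟩
      c * d * (+ p * + (p ^ suc k))     ≡⟨ cong (c * d *_) (ℤP.pos-* p (p ^ suc k)) ⟨
      c * d * + (p ^ suc (suc k))       ∎))
    where
    open ≡-Reasoning
    geometric≡0 : geometric a p ≡ 0ℤ mod p
    geometric≡0 = mod-trans (geometric-mod p (mod-∣ (p∣p^suc k) a≡1)) (n≡0-mod p)
    regroup : ∀ c d p q → c * q * (d * p) ≡ c * d * (p * q)
    regroup = solve-∀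

  ^-lift : ∀ {a e} → a ^ᶻ e ≡ 1ℤ mod p ^ 1 → ∀ m → a ^ᶻ (e ℕ.* p ^ m) ≡ 1ℤ mod p ^ suc m
  ^-lift {a} {e} a^e≡1 zero    = subst (λ k → a ^ᶻ k ≡ 1ℤ mod p ^ 1) (sym (ℕP.*-identityʳ e)) a^e≡1
  ^-lift {a} {e} a^e≡1 (suc m) = subst (_≡ 1ℤ mod p ^ suc (suc m)) power (^p-lift {m} (^-lift {a} {e} a^e≡1 m))
    where power : (a ^ᶻ (e ℕ.* p ^ m)) ^ᶻ p ≡ a ^ᶻ (e ℕ.* p ^ suc m)
          power = trans (ℤP.^-*-assoc a (e ℕ.* p ^ m) p) (cong (a ^ᶻ_) (regroup e p (p ^ m)))
            where regroup : ∀ e p x → e ℕ.* x ℕ.* p ≡ e ℕ.* (p ℕ.* x)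
                  regroup = ℕSolver.solve-∀

  mod-p⇒mod-p^1 : ∀ {a b} → a ≡ b mod p → a ≡ b mod p ^ 1
  mod-p⇒mod-p^1 = subst (_ ≡ _ mod_) (sym p^1≡p)

  mod-p^1⇒mod-p : ∀ {a b} → a ≡ b mod p ^ 1 → a ≡ b mod p
  mod-p^1⇒mod-p = subst (_ ≡ _ mod_) p^1≡p

  invertible-mod-p : ∀ {e} → 1 ℕ.≤ e → e ℕ.< p → ∃₂ λ u v → e ℕ.* u ≡ 1 ℕ.+ p ℕ.* v
  invertible-mod-p {e} 1≤e e<p =
    let u , eu≡1 = injective⇒surjective times-e times-e-injective (fromℕ< 1<p) in
    toℕ u , (e ℕ.* toℕ u) ℕ./ p , (begin
      e ℕ.* toℕ u                                        ≡⟨ ℕD.m≡m%n+[m/n]*n (e ℕ.* toℕ u) p ⟩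
      (e ℕ.* toℕ u) ℕ.% p ℕ.+ (e ℕ.* toℕ u) ℕ./ p ℕ.* p  ≡⟨ cong₂ ℕ._+_ (%≡1 u eu≡1) (ℕP.*-comm _ p) ⟩
      1 ℕ.+ p ℕ.* ((e ℕ.* toℕ u) ℕ./ p)                  ∎)
    where
    open ≡-Reasoning
    times-e : Fin p → Fin p
    times-e j = fromℕ< (ℕD.m%n<n (e ℕ.* toℕ j) p)
    toℕ-times-e : ∀ j → toℕ (times-e j) ≡ (e ℕ.* toℕ j) ℕ.% p
    toℕ-times-e j = FinP.toℕ-fromℕ< _
    %≡1 : ∀ u → times-e u ≡ fromℕ< 1<p → (e ℕ.* toℕ u) ℕ.% p ≡ 1
    %≡1 u eq = trans (sym (toℕ-times-e u)) (trans (cong toℕ eq) (FinP.toℕ-fromℕ< 1<p))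
    times-e-injective : ∀ {i j} → times-e i ≡ times-e j → i ≡ j
    times-e-injective {i} {j} eq = FinP.toℕ-injective (<-mod⇒≡ p (FinP.toℕ<n i) (FinP.toℕ<n j)
      (mod-p^1⇒mod-p (*-cancelˡ-mod 1 (<p⇒∤ 1≤e e<p) (mod-p⇒mod-p^1
        (subst₂ (_≡_mod p) (ℤP.pos-* e (toℕ i)) (ℤP.pos-* e (toℕ j))
          (%ℕ-injective-mod p (trans (sym (toℕ-times-e i)) (trans (cong toℕ eq) (toℕ-times-e j)))))))))

  linear-congruence-solvable : ∀ {e} → 1 ℕ.≤ e → e ℕ.< p → ∀ s → ∃ λ j → s + + (e ℕ.* j) ≡ 0ℤ mod p
  linear-congruence-solvable {e} 1≤e e<p s =
    let u , v , eu≡1+pv = invertible-mod-p 1≤e e<p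
        r = (- s) %ℕ p
    in u ℕ.* r , (begin
      s + + (e ℕ.* (u ℕ.* r))          ≡⟨ cong (λ x → s + + x) (sym (ℕP.*-assoc e u r)) ⟩
      s + + (e ℕ.* u ℕ.* r)            ≡⟨ cong (λ x → s + + (x ℕ.* r)) eu≡1+pv ⟩
      s + + ((1 ℕ.+ p ℕ.* v) ℕ.* r)    ≡⟨ cong (λ x → s + + x) (expand p v r) ⟩
      s + + (r ℕ.+ v ℕ.* r ℕ.* p)      ≈⟨ +-congˡ-mod s (+*-mod p (v ℕ.* r) r) ⟩
      s + + r                          ≈⟨ +-congˡ-mod s (mod-%ℕ p (- s)) ⟨
      s + - s                          ≡⟨ ℤP.+-inverseʳ s ⟩
      0ℤ                               ∎)
    where open mod-Reasoning p
          expand : ∀ p v r → (1 ℕ.+ p ℕ.* v) ℕ.* r ≡ r ℕ.+ v ℕ.* r ℕ.* p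
          expand = ℕSolver.solve-∀

  ^-reflects-≡1 : ∀ {k e a} → 1 ℕ.≤ e → e ℕ.< p → a ≡ 1ℤ mod p ^ suc k →
                  a ^ᶻ e ≡ 1ℤ mod p ^ suc (suc k) → a ≡ 1ℤ mod p ^ suc (suc k)
  ^-reflects-≡1 {k} {e} {a} 1≤e e<p a≡1 a^e≡1 =
    let u , v , eu≡1+pv = invertible-mod-p 1≤e e<p in begin
      a                      ≡⟨ ℤP.^-identityʳ a ⟨
      a ^ᶻ 1                 ≈⟨ ^-periodic-mod p (^p-lift {k} a≡1) 1 v ⟨
      a ^ᶻ (1 ℕ.+ p ℕ.* v)   ≡⟨ cong (a ^ᶻ_) eu≡1+pv ⟨
      a ^ᶻ (e ℕ.* u)         ≡⟨ ℤP.^-*-assoc a e u ⟨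
      (a ^ᶻ e) ^ᶻ u          ≈⟨ ^-cong-mod u a^e≡1 ⟩
      1ℤ ^ᶻ u                ≡⟨ ℤP.^-zeroˡ u ⟩
      1ℤ                     ∎
    where open mod-Reasoning (p ^ suc (suc k))

-- resid pr m a unfolds to a %ℕ p ^ m, so the lemmas on _%ℕ_ apply to it directly.
module PowersOf {p} (pr : Prime p) {q : ℤ} (p∤q : ¬ + p ∣ q) where
  open PrimePowers pr

  instance
    p^1≢0 : NonZero (p ^ 1)
    p^1≢0 = ℕP.m^n≢0 p 1

  q^≢0 : ∀ m t → ¬ q ^ᶻ t ≡ 0ℤ mod p ^ suc m
  q^≢0 m t q^t≡0 = ∤-^ p∤q t (mod-0⇒∣ (mod-∣ (p∣p^suc m) q^t≡0))

  q^i≡q^j⇒q^[j∸i]≡1 : ∀ {k i j} → i ℕ.≤ j → q ^ᶻ i ≡ q ^ᶻ j mod p ^ k →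
                      q ^ᶻ (j ∸ i) ≡ 1ℤ mod p ^ k
  q^i≡q^j⇒q^[j∸i]≡1 {k} {i} {j} i≤j q^i≡q^j = mod-sym (*-cancelˡ-mod k (∤-^ p∤q i) (begin
    q ^ᶻ i * 1ℤ              ≡⟨ ℤP.*-identityʳ (q ^ᶻ i) ⟩
    q ^ᶻ i                   ≈⟨ q^i≡q^j ⟩
    q ^ᶻ j                   ≡⟨ cong (q ^ᶻ_) (ℕP.m+[n∸m]≡n i≤j) ⟨
    q ^ᶻ (i ℕ.+ (j ∸ i))     ≡⟨ ℤP.^-distribˡ-+-* q i (j ∸ i) ⟩
    q ^ᶻ i * q ^ᶻ (j ∸ i)    ∎))
    where open mod-Reasoning (p ^ k)

  1≤resid-q^ : ∀ k → 1 ℕ.≤ resid pr 1 (q ^ᶻ k)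
  1≤resid-q^ k = ℕP.n≢0⇒n>0 (λ r≡0 → q^≢0 0 k (%ℕ≡⇒mod (p ^ 1) r≡0))

  -- q ^ k mod p is never 0, so one less than it indexes Fin (p ∸ 1).
  unit : ℕ → Fin (p ∸ 1)
  unit k = fromℕ< (ℕP.∸-monoˡ-< resid<p (1≤resid-q^ k))
    where resid<p : resid pr 1 (q ^ᶻ k) ℕ.< p
          resid<p = subst (resid pr 1 (q ^ᶻ k) ℕ.<_) p^1≡p (ℤD.n%ℕd<d (q ^ᶻ k) (p ^ 1))

  suc-unit : ∀ k → suc (toℕ (unit k)) ≡ resid pr 1 (q ^ᶻ k)
  suc-unit k = trans (cong suc (FinP.toℕ-fromℕ< _)) (ℕP.m+[n∸m]≡n (1≤resid-q^ k))

  unit-≡⇒mod : ∀ {i j} → unit i ≡ unit j → q ^ᶻ i ≡ q ^ᶻ j mod p ^ 1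
  unit-≡⇒mod {i} {j} eq =
    %ℕ-injective-mod (p ^ 1) (trans (sym (suc-unit i)) (trans (cong (suc ∘ toℕ) eq) (suc-unit j)))

  unit-≢-below-order : ∀ {M i j} → (∀ d → 1 ℕ.≤ d → d ℕ.< M → ¬ q ^ᶻ d ≡ 1ℤ mod p ^ 1) →
                       i ℕ.< j → j ℕ.< M → unit i ≢ unit j
  unit-≢-below-order {i = i} {j} no-return i<j j<M ui≡uj = no-return (j ∸ i) (ℕP.m<n⇒0<n∸m i<j)
    (ℕP.≤-<-trans (ℕP.m∸n≤m j i) j<M)
    (q^i≡q^j⇒q^[j∸i]≡1 {1} (ℕP.<⇒≤ i<j) (unit-≡⇒mod {i} {j} ui≡uj))

  unit-injective-below-order : ∀ {M} → (∀ d → 1 ℕ.≤ d → d ℕ.< M → ¬ q ^ᶻ d ≡ 1ℤ mod p ^ 1) →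
                               ∀ {i j} → i ℕ.< M → j ℕ.< M → unit i ≡ unit j → i ≡ j
  unit-injective-below-order no-return {i} {j} i<M j<M ui≡uj with ℕP.<-cmp i j
  ... | tri< i<j _ _ = ⊥-elim (unit-≢-below-order no-return i<j j<M ui≡uj)
  ... | tri≈ _ i≡j _ = i≡j
  ... | tri> _ _ j<i = ⊥-elim (unit-≢-below-order no-return j<i i<M (sym ui≡uj))

  period<p : ∃ λ e → 1 ℕ.≤ e × e ℕ.< p × q ^ᶻ e ≡ 1ℤ mod p ^ 1
  period<p =
    let i , j , i<j , ui≡uj = FinP.pigeonhole (ℕP.∸-monoʳ-< (ℕP.n<1+n 0) (ℕP.<⇒≤ 1<p)) (unit ∘ toℕ) in
    toℕ j ∸ toℕ i , ℕP.m<n⇒0<n∸m i<j , ℕP.≤-<-trans (ℕP.m∸n≤m (toℕ j) (toℕ i)) (FinP.toℕ<n j) ,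
    q^i≡q^j⇒q^[j∸i]≡1 {1} (ℕP.<⇒≤ i<j) (unit-≡⇒mod {toℕ i} {toℕ j} ui≡uj)

sumℤ-zeros : ∀ {k} (f : Fin k → ℤ) → (∀ b → f b ≡ 0ℤ) → sumℤ f ≡ 0ℤ
sumℤ-zeros {zero}  f f≡0 = refl
sumℤ-zeros {suc k} f f≡0 =
  cong₂ _+_ (f≡0 Fin.zero) (sumℤ-zeros (λ b → f (Fin.suc b)) (λ b → f≡0 (Fin.suc b)))

sumℤ-single : ∀ {k} (f : Fin k → ℤ) b₀ → f b₀ ≡ 1ℤ → (∀ b → b ≢ b₀ → f b ≡ 0ℤ) → sumℤ f ≡ 1ℤ
sumℤ-single {suc k} f Fin.zero     f₀≡1 others≡0 =
  cong₂ _+_ f₀≡1 (sumℤ-zeros (λ b → f (Fin.suc b)) (λ b → others≡0 (Fin.suc b) λ ()))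
sumℤ-single {suc k} f (Fin.suc b₀) fb₀≡1 others≡0 =
  cong₂ _+_ (others≡0 Fin.zero λ ())
            (sumℤ-single (λ b → f (Fin.suc b)) b₀ fb₀≡1
              (λ b b≢b₀ → others≡0 (Fin.suc b) (b≢b₀ ∘ FinP.suc-injective)))

J₀-suc : ∀ {N} (x z : Fin N) {t} → toℕ z ≡ suc t → J₀ N x z ≡ 1ℤ
J₀-suc x z z≡1+t with toℕ z | z≡1+t
... | .(suc _) | refl = refl

-- Edge is not decidable, but equality in ℤ is, so a goal a ≡ b may still be proved by cases on it.
≡-by-cases : ∀ {P : Set} {a b : ℤ} → (P → a ≡ b) → (¬ P → a ≡ b) → a ≡ b
≡-by-cases {a = a} {b} if-P if-¬P = decidable-stable (a ℤ.≟ b) λ a≢b → a≢b (if-¬P λ P → a≢b (if-P P))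

module Adjacency {p} (pr : Prime p) (q : ℤ) where

  edge⇒1 : ∀ {m M} → IsAdjacencyMatrix pr m q M → ∀ {x z} → Edge pr m q x z → M x z ≡ 1ℤ
  edge⇒1 adj {x} {z} = proj₁ (adj x z)

  ¬edge⇒0 : ∀ {m M} → IsAdjacencyMatrix pr m q M → ∀ {x z} → ¬ Edge pr m q x z → M x z ≡ 0ℤ
  ¬edge⇒0 adj {x} {z} = proj₂ (adj x z)

  adjacency-entries-agree : ∀ {m m′ M M′} → IsAdjacencyMatrix pr m q M → IsAdjacencyMatrix pr m′ q M′ →
    ∀ {x z x′ z′} → (Edge pr m q x z → Edge pr m′ q x′ z′) → (Edge pr m′ q x′ z′ → Edge pr m q x z) →
    M x z ≡ M′ x′ z′
  adjacency-entries-agree {m} {m′} adj adj′ to from = ≡-by-cases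
    (λ e → trans (edge⇒1 {m} adj e) (sym (edge⇒1 {m′} adj′ (to e))))
    (λ ¬e → trans (¬edge⇒0 {m} adj ¬e) (sym (¬edge⇒0 {m′} adj′ (¬e ∘ from))))

module LevelOne {p} (pr : Prime p) {q : ℤ} (gcd≡1 : gcd q (+ p) ≡ 1ℤ) where
  open PrimePowers pr
  open PowersOf pr (gcd≡1⇒∤ {q} gcd≡1)
  open Adjacency pr q

  p^1≡1+[p∸1] : p ^ 1 ≡ suc (p ∸ 1)
  p^1≡1+[p∸1] = trans p^1≡p (sym (ℕP.m+[n∸m]≡n (ℕP.<⇒≤ 1<p)))

  suc<p^1⇒<p∸1 : ∀ {t} → suc t ℕ.< p ^ 1 → t ℕ.< p ∸ 1
  suc<p^1⇒<p∸1 {t} 1+t<p^1 = ℕ.s<s⁻¹ (subst (suc t ℕ.<_) p^1≡1+[p∸1] 1+t<p^1)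

  <p∸1⇒suc<p^1 : ∀ {t} → t ℕ.< p ∸ 1 → suc t ℕ.< p ^ 1
  <p∸1⇒suc<p^1 {t} t<p-1 = subst (suc t ℕ.<_) (sym p^1≡1+[p∸1]) (s≤s t<p-1)

  ¬edge-to-0 : ∀ {x z} → toℕ z ≡ 0 → ¬ Edge pr 1 q x z
  ¬edge-to-0 z≡0 (t , _ , q^t≡z) = q^≢0 0 t (%ℕ≡⇒mod (p ^ 1) (trans q^t≡z z≡0))

  primitive⇒no-return : IsPrimitiveRootModPrime pr q →
                        ∀ d → 1 ℕ.≤ d → d ℕ.< p ∸ 1 → ¬ q ^ᶻ d ≡ 1ℤ mod p ^ 1
  primitive⇒no-return (_ , _ , no-smaller) d 1≤d d<p-1 q^d≡1 = no-smaller d 1≤d d<p-1 (%ℕ-cong (p ^ 1) q^d≡1)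

  edge-if-primitive : IsPrimitiveRootModPrime pr q → ∀ x z {t} → toℕ z ≡ suc t → Edge pr 1 q x z
  edge-if-primitive isPrimitive@(_ , q^[p-1]≡1 , _) x z {t} z≡1+t = y , y≡x , q^y≡z
    where
    t<p-1 : t ℕ.< p ∸ 1
    t<p-1 = suc<p^1⇒<p∸1 (subst (ℕ._< p ^ 1) z≡1+t (FinP.toℕ<n z))
    log : ∃ λ k → unit (toℕ k) ≡ fromℕ< t<p-1
    log = injective⇒surjective (unit ∘ toℕ)
      (λ {i} {j} → FinP.toℕ-injective ∘
        unit-injective-below-order (primitive⇒no-return isPrimitive) (FinP.toℕ<n i) (FinP.toℕ<n j))
      (fromℕ< t<p-1)
    k : ℕ
    k = toℕ (proj₁ log)
    -- q ^ (p - 1) ≡ 1 leaves the exponent free modulo p - 1, and y ≡ k modulo p - 1.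
    y : ℕ
    y = k ℕ.+ (p ∸ 1) ℕ.* (k ℕ.+ (p ∸ 1) ℕ.* toℕ x)
    y≡x : resid pr 1 (+ y) ≡ resid pr 1 (+ toℕ x)
    y≡x = %ℕ-cong (p ^ 1)
      (subst (+ y ≡ + toℕ x mod_) (sym p^1≡1+[p∸1]) (exponent-mod-suc (p ∸ 1) k (toℕ x)))
    q^y≡z : resid pr 1 (q ^ᶻ y) ≡ toℕ z
    q^y≡z = begin
      resid pr 1 (q ^ᶻ y) ≡⟨ %ℕ-cong (p ^ 1) (^-periodic-mod (p ∸ 1) q^[p-1]≡1′ k _) ⟩
      resid pr 1 (q ^ᶻ k) ≡⟨ suc-unit k ⟨
      suc (toℕ (unit k))  ≡⟨ cong suc (trans (cong toℕ (proj₂ log)) (FinP.toℕ-fromℕ< t<p-1)) ⟩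
      suc t               ≡⟨ z≡1+t ⟨
      toℕ z               ∎
      where open ≡-Reasoning
            q^[p-1]≡1′ : q ^ᶻ (p ∸ 1) ≡ 1ℤ mod p ^ 1
            q^[p-1]≡1′ = %ℕ-injective-mod (p ^ 1) q^[p-1]≡1

  ¬primitive⇒period<p-1 : ¬ IsPrimitiveRootModPrime pr q →
                           ∃ λ k → 1 ℕ.≤ k × k ℕ.< p ∸ 1 × q ^ᶻ k ≡ 1ℤ mod p ^ 1
  ¬primitive⇒period<p-1 ¬primitive
    with FinP.any? {n = p ∸ 1} (λ i → (1 ℕ.≤? toℕ i) ×-dec (resid pr 1 (q ^ᶻ toℕ i) ℕ.≟ resid pr 1 1ℤ))
  ... | yes (i , 1≤i , q^i≡1) = toℕ i , 1≤i , FinP.toℕ<n i , %ℕ-injective-mod (p ^ 1) q^i≡1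
  ... | no none = ⊥-elim (¬primitive (gcd≡1 , q^[p-1]≡1 , no-smaller))
    where
    no-smaller : ∀ k → 1 ℕ.≤ k → k ℕ.< p ∸ 1 → ¬ resid pr 1 (q ^ᶻ k) ≡ resid pr 1 1ℤ
    no-smaller k 1≤k k<p-1 q^k≡1 = none (fromℕ< k<p-1 ,
      subst (λ j → 1 ℕ.≤ j × resid pr 1 (q ^ᶻ j) ≡ resid pr 1 1ℤ) (sym (FinP.toℕ-fromℕ< k<p-1)) (1≤k , q^k≡1))
    exponent≡p-1 : ∀ {e} → 1 ℕ.≤ e → e ℕ.< p → q ^ᶻ e ≡ 1ℤ mod p ^ 1 → e ≡ p ∸ 1
    exponent≡p-1 {e} 1≤e e<p q^e≡1 with e ℕ.<? p ∸ 1
    ... | yes e<p-1 = ⊥-elim (no-smaller e 1≤e e<p-1 (%ℕ-cong (p ^ 1) q^e≡1))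
    ... | no  e≮p-1 = ℕP.≤-antisym (ℕP.<⇒≤pred e<p) (ℕP.≮⇒≥ e≮p-1)
    q^[p-1]≡1 : resid pr 1 (q ^ᶻ (p ∸ 1)) ≡ resid pr 1 1ℤ
    q^[p-1]≡1 = let e , 1≤e , e<p , q^e≡1 = period<p in
      subst (λ k → resid pr 1 (q ^ᶻ k) ≡ resid pr 1 1ℤ) (exponent≡p-1 1≤e e<p q^e≡1) (%ℕ-cong (p ^ 1) q^e≡1)

  -- Only the k < p - 1 residues q ^ i with i < k occur as targets.
  missing-edge : ∀ {k} → 1 ℕ.≤ k → k ℕ.< p ∸ 1 → q ^ᶻ k ≡ 1ℤ mod p ^ 1 →
                 ∃₂ λ x z → ∃ λ t → toℕ z ≡ suc t × ¬ Edge pr 1 q x z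
  missing-edge {suc k} _ k<p-1 q^k≡1 = z , z , toℕ t , FinP.toℕ-fromℕ< _ , no-edge
    where
    unhit : ∃ λ t → ∀ i → unit (toℕ i) ≢ t
    unhit = <-nonsurjective k<p-1 (unit ∘ toℕ)
    t : Fin (p ∸ 1)
    t = proj₁ unhit
    z : Fin (p ^ 1)
    z = fromℕ< (<p∸1⇒suc<p^1 (FinP.toℕ<n t))
    no-edge : ¬ Edge pr 1 q z z
    no-edge (y , _ , q^y≡z) = proj₂ unhit i (FinP.toℕ-injective (ℕP.suc-injective (begin
      suc (toℕ (unit (toℕ i)))  ≡⟨ cong (λ j → suc (toℕ (unit j))) (FinP.toℕ-fromℕ< y%k<k) ⟩
      suc (toℕ (unit r))        ≡⟨ suc-unit r ⟩
      resid pr 1 (q ^ᶻ r)       ≡⟨ %ℕ-cong (p ^ 1) q^r≡q^y ⟩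
      resid pr 1 (q ^ᶻ y)       ≡⟨ q^y≡z ⟩
      toℕ z                     ≡⟨ FinP.toℕ-fromℕ< _ ⟩
      suc (toℕ t)               ∎)))
      where
      open ≡-Reasoning
      r : ℕ
      r = y ℕ.% suc k
      y%k<k : r ℕ.< suc k
      y%k<k = ℕD.m%n<n y (suc k)
      i : Fin (suc k)
      i = fromℕ< y%k<k
      q^r≡q^y : q ^ᶻ r ≡ q ^ᶻ y mod p ^ 1
      q^r≡q^y = subst (λ w → q ^ᶻ r ≡ q ^ᶻ w mod p ^ 1) r+k[y/k]≡y
                  (mod-sym (^-periodic-mod (suc k) q^k≡1 r (y ℕ./ suc k)))
        where r+k[y/k]≡y : r ℕ.+ suc k ℕ.* (y ℕ./ suc k) ≡ y
              r+k[y/k]≡y = trans (cong (r ℕ.+_) (ℕP.*-comm (suc k) (y ℕ./ suc k)))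
                                 (sym (ℕD.m≡m%n+[m/n]*n y (suc k)))

  module _ {A₁ : Matrix (p ^ 1)} (adj : IsAdjacencyMatrix pr 1 q A₁) where

    A₁≡J₀-if-primitive : IsPrimitiveRootModPrime pr q → ∀ x z → A₁ x z ≡ J₀ (p ^ 1) x z
    A₁≡J₀-if-primitive isPrimitive x z with toℕ z in z≡
    ... | zero  = ¬edge⇒0 {m = 1} adj (¬edge-to-0 z≡)
    ... | suc t = edge⇒1 {m = 1} adj (edge-if-primitive isPrimitive x z z≡)

    A₁-below-J₀ : ∀ x z → (A₁ x z ≡ J₀ (p ^ 1) x z) ⊎ ((J₀ (p ^ 1) x z ≡ 1ℤ) × (A₁ x z ≡ 0ℤ))
    A₁-below-J₀ x z with toℕ z in z≡ | A₁ x z ℤ.≟ 1ℤ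
    ... | zero  | _       = inj₁ (¬edge⇒0 {m = 1} adj (¬edge-to-0 z≡))
    ... | suc t | yes A≡1 = inj₁ A≡1
    ... | suc t | no  A≢1 = inj₂ (refl , ¬edge⇒0 {m = 1} adj (A≢1 ∘ edge⇒1 {m = 1} adj))

    A₁-gap-if-¬primitive : ¬ IsPrimitiveRootModPrime pr q →
                           ∃₂ λ x z → (J₀ (p ^ 1) x z ≡ 1ℤ) × (A₁ x z ≡ 0ℤ)
    A₁-gap-if-¬primitive ¬primitive =
      let k , 1≤k , k<p-1 , q^k≡1 = ¬primitive⇒period<p-1 ¬primitive
          x , z , t , z≡1+t , ¬edge = missing-edge 1≤k k<p-1 q^k≡1
      in x , z , J₀-suc x z z≡1+t , ¬edge⇒0 {m = 1} adj ¬edge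

module Blocks {p} (pr : Prime p) {q : ℤ} (p∤q : ¬ + p ∣ q)
  {e} (1≤e : 1 ℕ.≤ e) (e<p : e ℕ.< p) (q^e≡1 : q ^ᶻ e ≡ 1ℤ mod p ^ 1) (r : ℕ) where
  open PrimePowers pr
  open PowersOf pr p∤q
  open Adjacency pr q

  K N : ℕ
  K = p ^ suc r
  N = p ^ suc (suc r)

  instance
    K≢0 : NonZero K
    K≢0 = ℕP.m^n≢0 p (suc r)

    N≢0 : NonZero N
    N≢0 = ℕP.m^n≢0 p (suc (suc r))

  mod-N⇒mod-K : ∀ {a b} → a ≡ b mod N → a ≡ b mod K
  mod-N⇒mod-K = mod-∣ (ℕ∣.n∣m*n p)

  E : ℕ
  E = e ℕ.* K

  q^E≡1 : q ^ᶻ E ≡ 1ℤ mod N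
  q^E≡1 = ^-lift {q} {e} q^e≡1 (suc r)

  -- E = e K with e invertible modulo p, so e j can cancel (t - x) / K modulo p.
  exponent-shift : ∀ {t x} → + t ≡ + x mod K → ∃ λ j → + (t ℕ.+ E ℕ.* j) ≡ + x mod N
  exponent-shift {t} {x} (≡-mod (divides s t-x≡sK)) =
    let j , s+ej≡0 = linear-congruence-solvable 1≤e e<p s
        divides c s+ej≡cp = mod-0⇒∣ s+ej≡0
    in j , ≡-mod (divides c (begin
      + (t ℕ.+ E ℕ.* j) - + x           ≡⟨ cong (_- + x) (trans (ℤP.pos-+ t (E ℕ.* j)) (cong (λ w → + t + w) (Ej≡ j))) ⟩
      + t + + (e ℕ.* j) * + K - + x     ≡⟨ regroup (+ t) (+ x) (+ (e ℕ.* j)) (+ K) ⟩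
      (+ t - + x) + + (e ℕ.* j) * + K   ≡⟨ cong (_+ + (e ℕ.* j) * + K) t-x≡sK ⟩
      s * + K + + (e ℕ.* j) * + K       ≡⟨ ℤP.*-distribʳ-+ (+ K) s (+ (e ℕ.* j)) ⟨
      (s + + (e ℕ.* j)) * + K           ≡⟨ cong (_* + K) s+ej≡cp ⟩
      c * + p * + K                     ≡⟨ ℤP.*-assoc c (+ p) (+ K) ⟩
      c * (+ p * + K)                   ≡⟨ cong (c *_) (ℤP.pos-* p K) ⟨
      c * + N                           ∎))
    where
    open ≡-Reasoning
    Ej≡ : ∀ j → + (E ℕ.* j) ≡ + (e ℕ.* j) * + K
    Ej≡ j = trans (cong +_ (swap e K j)) (ℤP.pos-* (e ℕ.* j) K)
      where swap : ∀ e K j → e ℕ.* K ℕ.* j ≡ e ℕ.* j ℕ.* K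
            swap = ℕSolver.solve-∀
    regroup : ∀ t x w K → t + w * K - x ≡ (t - x) + w * K
    regroup = solve-∀

  ^-period-lift : ∀ t d → q ^ᶻ t ≡ q ^ᶻ (t ℕ.+ N ℕ.* d) mod K → q ^ᶻ t ≡ q ^ᶻ (t ℕ.+ N ℕ.* d) mod N
  ^-period-lift t d q^t≡ = begin
    q ^ᶻ t                   ≡⟨ ℤP.*-identityʳ (q ^ᶻ t) ⟨
    q ^ᶻ t * 1ℤ              ≈⟨ *-congˡ-mod (q ^ᶻ t) (mod-sym a≡1) ⟩
    q ^ᶻ t * a               ≡⟨ split ⟨
    q ^ᶻ (t ℕ.+ N ℕ.* d)     ∎
    where
    open mod-Reasoning N
    a : ℤ
    a = q ^ᶻ (N ℕ.* d)
    split : q ^ᶻ (t ℕ.+ N ℕ.* d) ≡ q ^ᶻ t * a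
    split = ℤP.^-distribˡ-+-* q t (N ℕ.* d)
    a≡1-mod-K : a ≡ 1ℤ mod K
    a≡1-mod-K = mod-sym (*-cancelˡ-mod (suc r) (∤-^ p∤q t)
      (mod-trans (≡⇒mod (ℤP.*-identityʳ (q ^ᶻ t))) (mod-trans q^t≡ (≡⇒mod split))))
    a^e≡1 : a ^ᶻ e ≡ 1ℤ mod N
    a^e≡1 = subst (_≡ 1ℤ mod N) power (^-periodic-mod E q^E≡1 0 (p ℕ.* d))
      where power : q ^ᶻ (E ℕ.* (p ℕ.* d)) ≡ a ^ᶻ e
            power = trans (cong (q ^ᶻ_) (regroup e K p d)) (sym (ℤP.^-*-assoc q (N ℕ.* d) e))
              where regroup : ∀ e K p d → e ℕ.* K ℕ.* (p ℕ.* d) ≡ p ℕ.* K ℕ.* d ℕ.* e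
                    regroup = ℕSolver.solve-∀
    a≡1 : a ≡ 1ℤ mod N
    a≡1 = ^-reflects-≡1 {r} 1≤e e<p a≡1-mod-K a^e≡1

  ^-≡-lift-≤ : ∀ {t t′} → t ℕ.% N ≡ t′ ℕ.% N → t ℕ./ N ℕ.≤ t′ ℕ./ N →
               q ^ᶻ t ≡ q ^ᶻ t′ mod K → q ^ᶻ t ≡ q ^ᶻ t′ mod N
  ^-≡-lift-≤ {t} {t′} t≡t′ ≤ q^t≡q^t′ =
    subst (λ u → q ^ᶻ t ≡ q ^ᶻ u mod N) (sym t′≡)
      (^-period-lift t _ (subst (λ u → q ^ᶻ t ≡ q ^ᶻ u mod K) t′≡ q^t≡q^t′))
    where t′≡ : t′ ≡ t ℕ.+ N ℕ.* (t′ ℕ./ N ∸ t ℕ./ N)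
          t′≡ = %≡⇒≡+* N t≡t′ ≤

  ^-≡-lift : ∀ {t t′} → t ℕ.% N ≡ t′ ℕ.% N → q ^ᶻ t ≡ q ^ᶻ t′ mod K → q ^ᶻ t ≡ q ^ᶻ t′ mod N
  ^-≡-lift {t} {t′} t≡t′ q^t≡q^t′ with ℕP.≤-total (t ℕ./ N) (t′ ℕ./ N)
  ... | inj₁ ≤ = ^-≡-lift-≤ t≡t′ ≤ q^t≡q^t′
  ... | inj₂ ≥ = mod-sym (^-≡-lift-≤ (sym t≡t′) ≥ (mod-sym q^t≡q^t′))

  K≤N : K ℕ.≤ N
  K≤N = ℕP.m≤n*m K p

  embed : Fin K → Fin N
  embed y = Fin.inject≤ y K≤N

  embed-mod : ∀ y → + toℕ (embed y) ≡ + toℕ y mod N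
  embed-mod y = ≡⇒mod (cong +_ (FinP.toℕ-inject≤ y K≤N))

  toℕ-combine′ : ∀ b y′ → toℕ (Fin.combine {p} {K} b y′) ≡ toℕ y′ ℕ.+ toℕ b ℕ.* K
  toℕ-combine′ b y′ =
    trans (FinP.toℕ-combine b y′)
          (trans (ℕP.+-comm (K ℕ.* toℕ b) (toℕ y′)) (cong (toℕ y′ ℕ.+_) (ℕP.*-comm K (toℕ b))))

  block-mod : ∀ {n} {x : Fin n} (b : Fin p) (y : Fin K) →
              toℕ x ≡ toℕ y ℕ.+ toℕ b ℕ.* K → + toℕ x ≡ + toℕ y mod K
  block-mod b y x≡ = subst (_≡ + toℕ y mod K) (cong +_ (sym x≡)) (+*-mod K (toℕ b) (toℕ y))

  combine-mod : ∀ b y′ → + toℕ (Fin.combine {p} {K} b y′) ≡ + toℕ y′ mod K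
  combine-mod b y′ = block-mod b y′ (toℕ-combine′ b y′)

  edge-source-mod : ∀ {x₁ x₂ z} → + toℕ x₁ ≡ + toℕ x₂ mod K →
                    Edge pr (suc (suc r)) q x₁ z → Edge pr (suc (suc r)) q x₂ z
  edge-source-mod {x₁} x₁≡x₂ (t , t≡x₁ , q^t≡z) =
    let j , shifted =
          exponent-shift (mod-trans (mod-N⇒mod-K (%ℕ-injective-mod N {+ t} {+ toℕ x₁} t≡x₁)) x₁≡x₂) in
    t ℕ.+ E ℕ.* j , %ℕ-cong N shifted , trans (%ℕ-cong N (^-periodic-mod E q^E≡1 t j)) q^t≡z

  edge-reduce : ∀ {x z y y′} → + toℕ x ≡ + toℕ y mod K → + toℕ z ≡ + toℕ y′ mod K →
                Edge pr (suc (suc r)) q x z → Edge pr (suc r) q y y′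
  edge-reduce {x} {y′ = y′} x≡y z≡y′ (t , t≡x , q^t≡z) =
    t , %ℕ-cong K (mod-trans (mod-N⇒mod-K (%ℕ-injective-mod N {+ t} {+ toℕ x} t≡x)) x≡y) ,
    mod⇒%ℕ≡ K (FinP.toℕ<n y′) (mod-trans (mod-N⇒mod-K (%ℕ≡⇒mod N {q ^ᶻ t} q^t≡z)) z≡y′)

  edge-lift : ∀ {y y′} → Edge pr (suc r) q y y′ →
              ∃ λ b → Edge pr (suc (suc r)) q (embed y) (Fin.combine b y′)
  edge-lift {y} {y′} (t , t≡y , q^t≡y′) = lifted (exponent-shift (%ℕ-injective-mod K {+ t} {+ toℕ y} t≡y))
    where
    lifted : (∃ λ j → + (t ℕ.+ E ℕ.* j) ≡ + toℕ y mod N) →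
             ∃ λ b → Edge pr (suc (suc r)) q (embed y) (Fin.combine b y′)
    lifted (j , t′≡y) = b , t′ , t′≡embed-y , w≡combine
      where
      t′ w : ℕ
      t′ = t ℕ.+ E ℕ.* j
      w = resid pr (suc (suc r)) (q ^ᶻ t′)
      w/K<p : w ℕ./ K ℕ.< p
      w/K<p = ℕD.m<n*o⇒m/o<n (ℤD.n%ℕd<d (q ^ᶻ t′) N)
      b : Fin p
      b = fromℕ< w/K<p
      t′≡embed-y : resid pr (suc (suc r)) (+ t′) ≡ resid pr (suc (suc r)) (+ toℕ (embed y))
      t′≡embed-y = %ℕ-cong N (mod-trans t′≡y (mod-sym (embed-mod y)))
      w%K≡y′ : w ℕ.% K ≡ toℕ y′
      w%K≡y′ = mod⇒%ℕ≡ K (FinP.toℕ<n y′) (begin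
        + w           ≈⟨ mod-N⇒mod-K (mod-%ℕ N (q ^ᶻ t′)) ⟨
        q ^ᶻ t′       ≈⟨ mod-N⇒mod-K (^-periodic-mod E q^E≡1 t j) ⟩
        q ^ᶻ t        ≈⟨ %ℕ≡⇒mod K q^t≡y′ ⟩
        + toℕ y′      ∎)
        where open mod-Reasoning K
      w≡combine : w ≡ toℕ (Fin.combine b y′)
      w≡combine = begin
        w                             ≡⟨ ℕD.m≡m%n+[m/n]*n w K ⟩
        w ℕ.% K ℕ.+ w ℕ./ K ℕ.* K     ≡⟨ cong₂ (λ u v → u ℕ.+ v ℕ.* K) w%K≡y′ (sym (FinP.toℕ-fromℕ< w/K<p)) ⟩
        toℕ y′ ℕ.+ toℕ b ℕ.* K        ≡⟨ toℕ-combine′ b y′ ⟨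
        toℕ (Fin.combine b y′)        ∎
        where open ≡-Reasoning

  edge-lift-unique : ∀ {x y′ b₁ b₂} → Edge pr (suc (suc r)) q x (Fin.combine b₁ y′) →
                     Edge pr (suc (suc r)) q x (Fin.combine b₂ y′) → b₁ ≡ b₂
  edge-lift-unique {x} {y′} {b₁} {b₂} (t₁ , t₁≡x , q^t₁≡z₁) (t₂ , t₂≡x , q^t₂≡z₂) =
    FinP.combine-injectiveˡ b₁ y′ b₂ y′ (FinP.toℕ-injective (begin
      toℕ (Fin.combine b₁ y′)          ≡⟨ q^t₁≡z₁ ⟨
      resid pr (suc (suc r)) (q ^ᶻ t₁) ≡⟨ %ℕ-cong N q^t₁≡q^t₂ ⟩
      resid pr (suc (suc r)) (q ^ᶻ t₂) ≡⟨ q^t₂≡z₂ ⟩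
      toℕ (Fin.combine b₂ y′)          ∎))
    where
    open ≡-Reasoning
    q^t≡y′ : ∀ {t} b → resid pr (suc (suc r)) (q ^ᶻ t) ≡ toℕ (Fin.combine b y′) →
             q ^ᶻ t ≡ + toℕ y′ mod K
    q^t≡y′ {t} b q^t≡z = mod-trans (mod-N⇒mod-K (%ℕ≡⇒mod N {q ^ᶻ t} q^t≡z)) (combine-mod b y′)
    q^t₁≡q^t₂ : q ^ᶻ t₁ ≡ q ^ᶻ t₂ mod N
    q^t₁≡q^t₂ = ^-≡-lift {t₁} {t₂} (trans t₁≡x (sym t₂≡x))
      (mod-trans (q^t≡y′ {t₁} b₁ q^t₁≡z₁) (mod-sym (q^t≡y′ {t₂} b₂ q^t₂≡z₂)))

  module _ (A : (m : ℕ) → Matrix (p ^ m))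
           (adjₘ : IsAdjacencyMatrix pr (suc r) q (A (suc r)))
           (adjₙ : IsAdjacencyMatrix pr (suc (suc r)) q (A (suc (suc r)))) where

    block : Fin p → Matrix K
    block b y y′ = A (suc (suc r)) (embed y) (Fin.combine b y′)

    block-sum : ∀ y y′ → sumℤ (λ b → block b y y′) ≡ A (suc r) y y′
    block-sum y y′ = ≡-by-cases {Edge pr (suc r) q y y′}
      (λ edge → let b₀ , edge₀ = edge-lift edge in trans
        (sumℤ-single _ b₀ (edge⇒1 {suc (suc r)} adjₙ edge₀)
          (λ b b≢b₀ → ¬edge⇒0 {suc (suc r)} adjₙ (λ edge-b → b≢b₀ (edge-lift-unique edge-b edge₀))))
        (sym (edge⇒1 {suc r} adjₘ edge)))
      (λ ¬edge → trans
        (sumℤ-zeros _ (λ b → ¬edge⇒0 {suc (suc r)} adjₙ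
          (¬edge ∘ edge-reduce (mod-N⇒mod-K (embed-mod y)) (combine-mod b y′))))
        (sym (¬edge⇒0 {suc r} adjₘ ¬edge)))

    block-entry : ∀ (x z : Fin N) (b b′ : Fin p) (y y′ : Fin K) →
                  toℕ x ≡ toℕ y ℕ.+ toℕ b ℕ.* K → toℕ z ≡ toℕ y′ ℕ.+ toℕ b′ ℕ.* K →
                  A (suc (suc r)) x z ≡ block b′ y y′
    block-entry x z b b′ y y′ x≡ z≡
      with refl ← FinP.toℕ-injective {i = z} {Fin.combine b′ y′} (trans z≡ (sym (toℕ-combine′ b′ y′))) =
      adjacency-entries-agree {suc (suc r)} {suc (suc r)} adjₙ adjₙ
        (edge-source-mod x≡embed-y) (edge-source-mod (mod-sym x≡embed-y))
      where x≡embed-y : + toℕ x ≡ + toℕ (embed y) mod K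
            x≡embed-y = mod-trans (block-mod b y x≡) (mod-sym (mod-N⇒mod-K (embed-mod y)))

    block-form : Σ (Fin p → Matrix K) λ B
                   → (∀ y y′ → sumℤ (λ b → B b y y′) ≡ A (suc r) y y′)
                   × (∀ (x z : Fin N) (b b′ : Fin p) (y y′ : Fin K)
                      → toℕ x ≡ toℕ y ℕ.+ toℕ b ℕ.* K
                      → toℕ z ≡ toℕ y′ ℕ.+ toℕ b′ ℕ.* K
                      → A (suc (suc r)) x z ≡ B b′ y y′)
    block-form = block , block-sum , block-entry

lemma5 : ∀ {p} (pr : Prime p) (q : ℤ) → gcd q (ℤ.+ p) ≡ 1ℤ
    → (A : (m : ℕ) → Matrix (p ^ m))
    → (∀ m → 1 ℕ.≤ m → IsAdjacencyMatrix pr m q (A m))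
    → ((IsPrimitiveRootModPrime pr q → ∀ x z → A 1 x z ≡ J₀ (p ^ 1) x z)
       × (¬ IsPrimitiveRootModPrime pr q
           → (∀ x z → (A 1 x z ≡ J₀ (p ^ 1) x z) ⊎ ((J₀ (p ^ 1) x z ≡ 1ℤ) × (A 1 x z ≡ 0ℤ)))
             × (∃ λ x → ∃ λ z → (J₀ (p ^ 1) x z ≡ 1ℤ) × (A 1 x z ≡ 0ℤ))))
      × (∀ n → 1 ℕ.< n
           → Σ (Fin p → Matrix (p ^ (n ∸ 1))) λ B
               → (∀ y y′ → sumℤ (λ b → B b y y′) ≡ A (n ∸ 1) y y′)
               × (∀ (x z : Fin (p ^ n)) (b b′ : Fin p) (y y′ : Fin (p ^ (n ∸ 1)))
                  → toℕ x ≡ toℕ y ℕ.+ toℕ b ℕ.* p ^ (n ∸ 1)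
                  → toℕ z ≡ toℕ y′ ℕ.+ toℕ b′ ℕ.* p ^ (n ∸ 1)
                  → A n x z ≡ B b′ y y′))
lemma5 {p} pr q gcd≡1 A adj =
  (A₁≡J₀-if-primitive adj₁ , λ ¬primitive → A₁-below-J₀ adj₁ , A₁-gap-if-¬primitive adj₁ ¬primitive) ,
  λ { zero ()
    ; (suc zero) (s≤s ())
    ; (suc (suc r)) _ → let e , 1≤e , e<p , q^e≡1 = period<p in
        Blocks.block-form pr p∤q 1≤e e<p q^e≡1 r A (adj _ (s≤s z≤n)) (adj _ (s≤s z≤n)) }
  where
  open LevelOne pr {q} gcd≡1
  adj₁ : IsAdjacencyMatrix pr 1 q (A 1)
  adj₁ = adj 1 (s≤s z≤n)
  p∤q : ¬ ℤ.+ p ∣ q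
  p∤q = PrimePowers.gcd≡1⇒∤ pr {q} gcd≡1
  open PowersOf pr p∤q using (period<p)
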